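{- Let $\Phi_f$ be a three-array scheme with query function $f(x,y,z)=(x\wedge y\wedge z)\vee(\bar y\wedge\bar z)$. If $\Phi_f$ is forced, then it cannot represent all sets of size at most $n$, i.e., there is $S\subseteq[m]$ with $|S|\le n$ such that no memory assignment satisfies: for all $u\in[m]$, $f(A[x(u)],B[y(u)],C[z(u)])=1$ iff $u\in S$.
   Context: A three-array scheme: memory consists of three bit arrays $A[1..s],B[1..s],C[1..s]$; each $u\in[m]$ has probe locations $x(u)\in A$, $y(u)\in B$, $z(u)\in C$. $G_{B,C}([m])$ is the bipartite multigraph with vertex classes $B=[s]$, $C=[s]$ and, for each $u\in[m]$, an edge labelled $u$ joining $y(u)$ and $z(u)$. $\Phi_f$ is forced if in $G_{B,C}([m])$ at least one holds: (P1) there is a cycle $C$ of length at most $\frac n2$ and two distinct elements $u_1,u_2\in[m]$ labelling edges of $C$ with $x(u_1)=x(u_2)$; (P2) there are edge-disjoint cycles $C_1,C_2$, each of length at most $\frac n2$, and elements $u,v\in[m]$ labelling an edge of $C_1$ and an edge of $C_2$ respectively, with $x(u)=x(v)$. -}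

module Defs where

open import Data.Nat as ℕ using (ℕ; zero; suc; _*_; _≤_)
open import Data.Fin using (Fin; zero; suc; toℕ; lower₁)
open import Data.Fin.Subset using (Subset; _∈_; ∣_∣)
open import Data.Bool using (Bool; true; false; _∧_; _∨_; not)
open import Data.Product using (Σ; ∃; ∃-syntax; _×_; _,_)
open import Data.Sum using (_⊎_)
open import Relation.Binary.PropositionalEquality using (_≡_; _≢_)
open import Relation.Nullary using (¬_; yes; no)

next : ∀ {k} → Fin (suc k) → Fin (suc k)
next {k} i with k ℕ.≟ toℕ i
... | yes _ = zero
... | no ne = suc (lower₁ i ne)

f : Bool → Bool → Bool → Bool
f a b c = (a ∧ b ∧ c) ∨ (not b ∧ not c)

record Scheme (m s : ℕ) : Set where
  field
    x y z : Fin m → Fin s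
open Scheme public

-- A cycle in the bipartite multigraph G_{B,C}([m]) (left class B = [s],
-- right class C = [s], edge labelled u joins y(u) ∈ B and z(u) ∈ C).
-- A cycle of length 2(k+1) visits left vertices b₀,…,b_k (distinct) and
-- right vertices c₀,…,c_k (distinct) via edges
--   a i : b_i — c_i      and      d i : c_i — b_{i+1 mod (k+1)},
-- all 2(k+1) edge labels distinct. Here b_i = y (a i), c_i = z (a i).
record Cycle {m s : ℕ} (Φ : Scheme m s) : Set where
  field
    k : ℕ
    a d : Fin (suc k) → Fin m
    a-inj : ∀ i j → a i ≡ a j → i ≡ j
    d-inj : ∀ i j → d i ≡ d j → i ≡ j
    a≢d : ∀ i j → a i ≢ d j
    left-distinct  : ∀ i j → y Φ (a i) ≡ y Φ (a j) → i ≡ j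
    right-distinct : ∀ i j → z Φ (a i) ≡ z Φ (a j) → i ≡ j
    d-right : ∀ i → z Φ (d i) ≡ z Φ (a i)
    d-left  : ∀ i → y Φ (d i) ≡ y Φ (a (next i))

  length : ℕ
  length = 2 * suc k
open Cycle public

_onCycle_ : ∀ {m s} {Φ : Scheme m s} → Fin m → Cycle Φ → Set
u onCycle C = ∃[ i ] (a C i ≡ u ⊎ d C i ≡ u)

-- length(C) ≤ n/2, i.e. 2·length(C) ≤ n
Short : ∀ {m s} {Φ : Scheme m s} → ℕ → Cycle Φ → Set
Short n C = 2 * length C ≤ n

EdgeDisjoint : ∀ {m s} {Φ : Scheme m s} → Cycle Φ → Cycle Φ → Set
EdgeDisjoint {m} C₁ C₂ = ∀ (u : Fin m) → u onCycle C₁ → ¬ (u onCycle C₂)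

P1 : ∀ {m s} → ℕ → Scheme m s → Set
P1 {m} n Φ = Σ (Cycle Φ) λ C → Short n C ×
  ∃[ u₁ ] ∃[ u₂ ] (u₁ ≢ u₂ × u₁ onCycle C × u₂ onCycle C × x Φ u₁ ≡ x Φ u₂)

P2 : ∀ {m s} → ℕ → Scheme m s → Set
P2 {m} n Φ = Σ (Cycle Φ) λ C₁ → Σ (Cycle Φ) λ C₂ →
  EdgeDisjoint C₁ C₂ × Short n C₁ × Short n C₂ ×
  ∃[ u ] ∃[ v ] (u onCycle C₁ × v onCycle C₂ × x Φ u ≡ x Φ v)

Forced : ∀ {m s} → ℕ → Scheme m s → Set
Forced n Φ = P1 n Φ ⊎ P2 n Φ

Represents : ∀ {m s} → Scheme m s → (A B C : Fin s → Bool) → Subset m → Set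
Represents Φ A B C S = ∀ u →
  (f (A (x Φ u)) (B (y Φ u)) (C (z Φ u)) ≡ true → u ∈ S) ×
  (u ∈ S → f (A (x Φ u)) (B (y Φ u)) (C (z Φ u)) ≡ true)

-- If a set S contains every edge of a cycle of G_{B,C} except one edge e,
-- then f = 1 on those edges forces B[y(g)] = C[z(g)] for each of them, and
-- walking around the cycle, which is broken only at e, makes all the B- and
-- C-bits on the cycle equal to one bit w.  Since f(a,0,0) = 1 while e ∉ S,
-- w = 1; then f reduces to A[x(g)] on the cycle, so A[x(e)] = 0 and
-- A[x(g)] = 1 for every other cycle edge g.  Under (P1) choose e = u₁ (with
-- |S| < n/2); under (P2) put into S the edges of C₁ except u and the edges of
-- C₂ except some edge other than v (with |S| < n).  In both cases two edges
-- with the same probe x would need different A-bits.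
module Submission where

open import Defs
open import Data.Bool using (Bool; true; false)
open import Data.Bool.Properties using (¬-not)
open import Data.Fin as Fin using (Fin; zero; suc; toℕ; inject₁; fromℕ)
open import Data.Fin.Induction using (<-weakInduction; >-weakInduction)
open import Data.Fin.Properties
  using (≤-refl; toℕ-fromℕ; toℕ-inject₁-≢; lower₁-inject₁′; <⇒≢; ℕ<⇒inject₁<; ≤̄⇒inject₁<; <-trans)
open import Data.Fin.Subset using (Subset; ∣_∣; _∈_; _∉_; _∪_; _-_; ⁅_⁆; ⊥; inside; outside)
open import Data.Fin.Subset.Properties
  using (x∈⁅x⁆; x∈⁅y⁆⇒x≡y; ∉⊥; ∣⊥∣≡0; ∣⁅x⁆∣≡1; x∈p∪q⁺; x∈p∪q⁻; p─q⊆p; ∣p─q∣≤∣p∣; x∈p∧x≢y⇒x∈p-y)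
open import Data.List as List using (List; []; _∷_; _++_; tabulate)
open import Data.List.Membership.Propositional using () renaming (_∈_ to _∈ˡ_)
open import Data.List.Membership.Propositional.Properties
  using (∈-++⁺ˡ; ∈-++⁺ʳ; ∈-++⁻; ∈-tabulate⁺; ∈-tabulate⁻)
open import Data.List.Properties using (length-++; length-tabulate)
open import Data.List.Relation.Unary.Any as Any using ()
open import Data.Nat using (ℕ; suc; _+_; _*_; _⊔_; _≤_; _≟_; z≤n; s≤s)
open import Data.Nat.Properties
  using (≤-trans; ≤-reflexive; n≤1+n; +-suc; +-monoʳ-≤; +-mono-≤; m≤m+n; m≤m⊔n; m≤n⊔m; ⊔-lub;
         *-distribˡ-⊔; <⇒≤; ≰⇒>; module ≤-Reasoning)
open import Data.Product using (Σ; ∃-syntax; _×_; _,_; proj₁; proj₂)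
open import Data.Sum using (inj₁; inj₂; [_,_]′)
open import Data.Vec as Vec using (_∷_)
open import Function using (_∘_)
open import Level using (Level)
open import Relation.Binary.PropositionalEquality
open import Relation.Nullary using (¬_; yes; no; contradiction)

private
  variable
    ℓ : Level
    m s : ℕ

next-inject₁ : {k : ℕ} (i : Fin k) → next (inject₁ i) ≡ suc i
next-inject₁ {k} i with k ≟ toℕ (inject₁ i)
... | yes k≡i = contradiction k≡i (toℕ-inject₁-≢ i)
... | no k≢i  = cong suc (lower₁-inject₁′ i k≢i)

next-fromℕ : ∀ k → next (fromℕ k) ≡ zero
next-fromℕ k with k ≟ toℕ (fromℕ k)
... | yes _   = refl
... | no k≢k  = contradiction (sym (toℕ-fromℕ k)) k≢k

-- Below the break we walk up from zero; above it we walk down from the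
-- last index, which wraps around to zero because the break is not there.
next-stable-except-one⇒constant : {X : Set ℓ} {k : ℕ} (W : Fin (suc k) → X) (i₀ : Fin (suc k)) →
  (∀ i → i ≢ i₀ → W i ≡ W (next i)) → ∀ i → W i ≡ W zero
next-stable-except-one⇒constant {k = k} W i₀ step i with i Fin.≤? i₀
... | yes i≤i₀ = below i i≤i₀
  where
  below : ∀ i → i Fin.≤ i₀ → W i ≡ W zero
  below = <-weakInduction (λ i → i Fin.≤ i₀ → W i ≡ W zero) (λ _ → refl) λ j IH j<i₀ →
    let j<i₀′ = ℕ<⇒inject₁< j<i₀ in
    trans (cong W (sym (next-inject₁ j)))
          (trans (sym (step (inject₁ j) (<⇒≢ j<i₀′))) (IH (<⇒≤ j<i₀′)))
... | no i≰i₀ = above i (≰⇒> i≰i₀)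
  where
  above : ∀ i → i₀ Fin.< i → W i ≡ W zero
  above = >-weakInduction (λ i → i₀ Fin.< i → W i ≡ W zero)
    (λ i₀<k → trans (step (fromℕ k) (<⇒≢ i₀<k ∘ sym)) (cong W (next-fromℕ k)))
    λ j IH i₀<j → trans (step (inject₁ j) (<⇒≢ i₀<j ∘ sym))
                        (trans (cong W (next-inject₁ j)) (IH (<-trans i₀<j (≤̄⇒inject₁< ≤-refl))))

module _ {Φ : Scheme m s} (Cy : Cycle Φ) {X : Set ℓ} (β γ : Fin s → X) where

  private
    b c : Fin (suc (k Cy)) → X
    b i = β (y Φ (a Cy i))
    c i = γ (z Φ (a Cy i))

    d-agrees : ∀ i → β (y Φ (d Cy i)) ≡ γ (z Φ (d Cy i)) → c i ≡ b (next i)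
    d-agrees i eq = trans (sym (cong γ (d-right Cy i))) (trans (sym eq) (cong β (d-left Cy i)))

    ends-constant : (∀ i → b i ≡ b zero × c i ≡ b zero) →
      ∀ g → g onCycle Cy → β (y Φ g) ≡ b zero × γ (z Φ g) ≡ b zero
    ends-constant bc≡ g (i , inj₁ refl) = bc≡ i
    ends-constant bc≡ g (i , inj₂ refl) =
      trans (cong β (d-left Cy i)) (proj₁ (bc≡ (next i))) ,
      trans (cong γ (d-right Cy i)) (proj₂ (bc≡ i))

  -- An a-edge equates b_i with c_i and a d-edge equates c_i with b_{i+1}, so
  -- the agreeing edges give b_i ≡ b_{i+1} at every step but one.
  agreeing-except-one⇒constant : ∀ {e} → e onCycle Cy →
    (∀ g → g onCycle Cy → g ≢ e → β (y Φ g) ≡ γ (z Φ g)) →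
    ∃[ w ] ∀ g → g onCycle Cy → β (y Φ g) ≡ w × γ (z Φ g) ≡ w
  agreeing-except-one⇒constant (i₀ , inj₁ refl) agree = b zero , ends-constant λ i →
    let c≡b+ : ∀ i → c i ≡ b (next i)
        c≡b+ i = d-agrees i (agree (d Cy i) (i , inj₂ refl) (a≢d Cy i₀ i ∘ sym))
        b-const = next-stable-except-one⇒constant b i₀ λ i i≢i₀ →
          trans (agree (a Cy i) (i , inj₁ refl) (i≢i₀ ∘ a-inj Cy i i₀)) (c≡b+ i)
    in b-const i , trans (c≡b+ i) (b-const (next i))
  agreeing-except-one⇒constant (i₀ , inj₂ refl) agree = b zero , ends-constant λ i →
    let b≡c : ∀ i → b i ≡ c i
        b≡c i = agree (a Cy i) (i , inj₁ refl) (a≢d Cy i i₀)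
        b-const = next-stable-except-one⇒constant b i₀ λ i i≢i₀ →
          trans (b≡c i) (d-agrees i (agree (d Cy i) (i , inj₂ refl) (i≢i₀ ∘ d-inj Cy i i₀)))
    in b-const i , trans (sym (b≡c i)) (b-const i)

f-true⇒≡ : ∀ p q r → f p q r ≡ true → q ≡ r
f-true⇒≡ true  true  true  _ = refl
f-true⇒≡ false true  true  _ = refl
f-true⇒≡ true  false false _ = refl
f-true⇒≡ false false false _ = refl

f-false-false : ∀ p → f p false false ≡ true
f-false-false true  = refl
f-false-false false = refl

f-true-true : ∀ p → f p true true ≡ p
f-true-true true  = refl
f-true-true false = refl

module _ {Φ : Scheme m s} {S : Subset m} (A B C : Fin s → Bool)
         (rep : Represents Φ A B C S) (Cy : Cycle Φ) {e : Fin m} (e∈Cy : e onCycle Cy) (e∉S : e ∉ S)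
         (rest⊆S : ∀ {g} → g onCycle Cy → g ≢ e → g ∈ S) where

  private
    query : Fin m → Bool
    query u = f (A (x Φ u)) (B (y Φ u)) (C (z Φ u))

    constant : ∃[ w ] ∀ g → g onCycle Cy → B (y Φ g) ≡ w × C (z Φ g) ≡ w
    constant = agreeing-except-one⇒constant Cy B C e∈Cy λ g g∈Cy g≢e →
      f-true⇒≡ (A (x Φ g)) (B (y Φ g)) (C (z Φ g)) (proj₂ (rep g) (rest⊆S g∈Cy g≢e))
    w : Bool
    w = proj₁ constant

    query≡ : ∀ g → g onCycle Cy → query g ≡ f (A (x Φ g)) w w
    query≡ g g∈Cy = cong₂ (f (A (x Φ g))) (proj₁ (proj₂ constant g g∈Cy)) (proj₂ (proj₂ constant g g∈Cy))

    query-e≢true : query e ≢ true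
    query-e≢true = e∉S ∘ proj₁ (rep e)

    w≡true : w ≡ true
    w≡true = ¬-not λ w≡false → query-e≢true (begin
      query e                      ≡⟨ query≡ e e∈Cy ⟩
      f (A (x Φ e)) w w            ≡⟨ cong (λ v → f (A (x Φ e)) v v) w≡false ⟩
      f (A (x Φ e)) false false    ≡⟨ f-false-false (A (x Φ e)) ⟩
      true                         ∎)
      where open ≡-Reasoning

    query≡A : ∀ g → g onCycle Cy → query g ≡ A (x Φ g)
    query≡A g g∈Cy = begin
      query g                  ≡⟨ query≡ g g∈Cy ⟩
      f (A (x Φ g)) w w        ≡⟨ cong (λ v → f (A (x Φ g)) v v) w≡true ⟩
      f (A (x Φ g)) true true  ≡⟨ f-true-true (A (x Φ g)) ⟩
      A (x Φ g)                ∎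
      where open ≡-Reasoning

  omitted-edge-probe-false : A (x Φ e) ≡ false
  omitted-edge-probe-false = ¬-not (query-e≢true ∘ trans (query≡A e e∈Cy))

  other-edge-probe-true : ∀ g → g onCycle Cy → g ≢ e → A (x Φ g) ≡ true
  other-edge-probe-true g g∈Cy g≢e = trans (sym (query≡A g g∈Cy)) (proj₂ (rep g) (rest⊆S g∈Cy g≢e))

∣p∪q∣≤∣p∣+∣q∣ : ∀ {n} (p q : Subset n) → ∣ p ∪ q ∣ ≤ ∣ p ∣ + ∣ q ∣
∣p∪q∣≤∣p∣+∣q∣ Vec.[]        Vec.[]        = z≤n
∣p∪q∣≤∣p∣+∣q∣ (inside  ∷ p) (inside  ∷ q) = s≤s (≤-trans (∣p∪q∣≤∣p∣+∣q∣ p q) (+-monoʳ-≤ ∣ p ∣ (n≤1+n ∣ q ∣)))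
∣p∪q∣≤∣p∣+∣q∣ (inside  ∷ p) (outside ∷ q) = s≤s (∣p∪q∣≤∣p∣+∣q∣ p q)
∣p∪q∣≤∣p∣+∣q∣ (outside ∷ p) (inside  ∷ q) = ≤-trans (s≤s (∣p∪q∣≤∣p∣+∣q∣ p q)) (≤-reflexive (sym (+-suc ∣ p ∣ ∣ q ∣)))
∣p∪q∣≤∣p∣+∣q∣ (outside ∷ p) (outside ∷ q) = ∣p∪q∣≤∣p∣+∣q∣ p q

x∉p-x : ∀ {n} {p : Subset n} (i : Fin n) → i ∉ p - i
x∉p-x {p = _ ∷ _} zero    ()
x∉p-x {p = _ ∷ _} (suc i) (Vec.there i∈p-i) = x∉p-x i i∈p-i

fromList : List (Fin m) → Subset m
fromList []       = ⊥
fromList (u ∷ us) = ⁅ u ⁆ ∪ fromList us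

∣fromList∣≤length : (us : List (Fin m)) → ∣ fromList us ∣ ≤ List.length us
∣fromList∣≤length {m} []   = ≤-reflexive (∣⊥∣≡0 m)
∣fromList∣≤length (u ∷ us) = begin
  ∣ ⁅ u ⁆ ∪ fromList us ∣        ≤⟨ ∣p∪q∣≤∣p∣+∣q∣ ⁅ u ⁆ (fromList us) ⟩
  ∣ ⁅ u ⁆ ∣ + ∣ fromList us ∣    ≡⟨ cong (_+ ∣ fromList us ∣) (∣⁅x⁆∣≡1 u) ⟩
  suc ∣ fromList us ∣            ≤⟨ s≤s (∣fromList∣≤length us) ⟩
  suc (List.length us)            ∎
  where open ≤-Reasoning

∈fromList⁺ : ∀ {u : Fin m} {us} → u ∈ˡ us → u ∈ fromList us
∈fromList⁺ (Any.here refl) = x∈p∪q⁺ (inj₁ (x∈⁅x⁆ _))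
∈fromList⁺ (Any.there u∈us) = x∈p∪q⁺ (inj₂ (∈fromList⁺ u∈us))

∈fromList⁻ : ∀ {u : Fin m} us → u ∈ fromList us → u ∈ˡ us
∈fromList⁻ []       u∈⊥ = contradiction u∈⊥ ∉⊥
∈fromList⁻ (v ∷ vs) u∈  = [ Any.here ∘ x∈⁅y⁆⇒x≡y v , Any.there ∘ ∈fromList⁻ vs ]′ (x∈p∪q⁻ ⁅ v ⁆ (fromList vs) u∈)

module _ {Φ : Scheme m s} (Cy : Cycle Φ) where

  edgeList : List (Fin m)
  edgeList = tabulate (a Cy) ++ tabulate (d Cy)

  edgeSet : Subset m
  edgeSet = fromList edgeList

  ∣edgeSet∣≤length : ∣ edgeSet ∣ ≤ length Cy
  ∣edgeSet∣≤length = begin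
    ∣ edgeSet ∣                                   ≤⟨ ∣fromList∣≤length edgeList ⟩
    List.length edgeList                          ≡⟨ length-++ (tabulate (a Cy)) ⟩
    List.length (tabulate (a Cy)) + List.length (tabulate (d Cy))
                                                  ≡⟨ cong₂ _+_ (length-tabulate (a Cy)) (length-tabulate (d Cy)) ⟩
    suc (k Cy) + suc (k Cy)                       ≤⟨ +-monoʳ-≤ (suc (k Cy)) (m≤m+n _ 0) ⟩
    length Cy                                     ∎
    where open ≤-Reasoning

  ∈edgeSet⁺ : ∀ {u} → u onCycle Cy → u ∈ edgeSet
  ∈edgeSet⁺ (i , inj₁ refl) = ∈fromList⁺ (∈-++⁺ˡ (∈-tabulate⁺ {f = a Cy} i))
  ∈edgeSet⁺ (i , inj₂ refl) = ∈fromList⁺ (∈-++⁺ʳ (tabulate (a Cy)) (∈-tabulate⁺ {f = d Cy} i))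

  ∈edgeSet⁻ : ∀ {u} → u ∈ edgeSet → u onCycle Cy
  ∈edgeSet⁻ u∈ with ∈-++⁻ (tabulate (a Cy)) (∈fromList⁻ edgeList u∈)
  ... | inj₁ u∈a = let i , u≡ = ∈-tabulate⁻ {f = a Cy} u∈a in i , inj₁ (sym u≡)
  ... | inj₂ u∈d = let i , u≡ = ∈-tabulate⁻ {f = d Cy} u∈d in i , inj₂ (sym u≡)

  ∈edgeSet-⁺ : ∀ {g e} → g onCycle Cy → g ≢ e → g ∈ edgeSet - e
  ∈edgeSet-⁺ g∈Cy = x∈p∧x≢y⇒x∈p-y (∈edgeSet⁺ g∈Cy)

  ∈edgeSet-⁻ : ∀ {g e} → g ∈ edgeSet - e → g onCycle Cy
  ∈edgeSet-⁻ {e = e} = ∈edgeSet⁻ ∘ p─q⊆p edgeSet ⁅ e ⁆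

  ∣edgeSet-e∣≤length : ∀ e → ∣ edgeSet - e ∣ ≤ length Cy
  ∣edgeSet-e∣≤length e = ≤-trans (∣p─q∣≤∣p∣ edgeSet ⁅ e ⁆) ∣edgeSet∣≤length

  other-edge : ∀ {u} → u onCycle Cy → ∃[ v ] v onCycle Cy × v ≢ u
  other-edge (i , inj₁ refl) = d Cy i , (i , inj₂ refl) , a≢d Cy i i ∘ sym
  other-edge (i , inj₂ refl) = a Cy i , (i , inj₁ refl) , a≢d Cy i i

+≤-from-double≤ : ∀ {p q n} → 2 * p ≤ n → 2 * q ≤ n → p + q ≤ n
+≤-from-double≤ {p} {q} {n} 2p≤n 2q≤n = begin
  p + q          ≤⟨ +-mono-≤ (m≤m⊔n p q) (≤-trans (m≤n⊔m p q) (m≤m+n _ 0)) ⟩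
  2 * (p ⊔ q)    ≡⟨ *-distribˡ-⊔ 2 p q ⟩
  2 * p ⊔ 2 * q  ≤⟨ ⊔-lub 2p≤n 2q≤n ⟩
  n              ∎
  where open ≤-Reasoning

HasUnrepresentableSet : ℕ → Scheme m s → Set
HasUnrepresentableSet {m} n Φ =
  Σ (Subset m) λ S → ∣ S ∣ ≤ n × ¬ (∃[ A ] ∃[ B ] ∃[ C ] Represents Φ A B C S)

P1⇒unrepresentable : ∀ {n} {Φ : Scheme m s} → P1 n Φ → HasUnrepresentableSet n Φ
P1⇒unrepresentable {Φ = Φ} (Cy , short , u₁ , u₂ , u₁≢u₂ , u₁∈Cy , u₂∈Cy , x≡) =
  S , ≤-trans (∣edgeSet-e∣≤length Cy u₁) (≤-trans (m≤m+n _ _) short) ,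
  λ (A , B , C , rep) → contradiction (begin
    false      ≡⟨ omitted-edge-probe-false A B C rep Cy u₁∈Cy u₁∉S (∈edgeSet-⁺ Cy) ⟨
    A (x Φ u₁) ≡⟨ cong A x≡ ⟩
    A (x Φ u₂) ≡⟨ other-edge-probe-true A B C rep Cy u₁∈Cy u₁∉S (∈edgeSet-⁺ Cy) u₂ u₂∈Cy (u₁≢u₂ ∘ sym) ⟩
    true       ∎) λ ()
  where
  open ≡-Reasoning
  S : Subset _
  S = edgeSet Cy - u₁
  u₁∉S : u₁ ∉ S
  u₁∉S = x∉p-x u₁

-- C₂ keeps its edge v in S and omits some other edge v′ instead.
P2⇒unrepresentable : ∀ {n} {Φ : Scheme m s} → P2 n Φ → HasUnrepresentableSet n Φ
P2⇒unrepresentable {Φ = Φ} (C₁ , C₂ , disjoint , short₁ , short₂ , u , v , u∈C₁ , v∈C₂ , x≡) =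
  S ,
  ≤-trans (∣p∪q∣≤∣p∣+∣q∣ S₁ S₂)
    (≤-trans (+-mono-≤ (∣edgeSet-e∣≤length C₁ u) (∣edgeSet-e∣≤length C₂ v′))
             (+≤-from-double≤ {length C₁} {length C₂} short₁ short₂)) ,
  λ (A , B , C , rep) → contradiction (begin
    false     ≡⟨ omitted-edge-probe-false A B C rep C₁ u∈C₁ u∉S (λ g∈ g≢u → x∈p∪q⁺ (inj₁ (∈edgeSet-⁺ C₁ g∈ g≢u))) ⟨
    A (x Φ u) ≡⟨ cong A x≡ ⟩
    A (x Φ v) ≡⟨ other-edge-probe-true A B C rep C₂ v′∈C₂ v′∉S (λ g∈ g≢v′ → x∈p∪q⁺ (inj₂ (∈edgeSet-⁺ C₂ g∈ g≢v′)))
                   v v∈C₂ (v′≢v ∘ sym) ⟩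
    true      ∎) λ ()
  where
  open ≡-Reasoning
  v′ : Fin _
  v′ = proj₁ (other-edge C₂ v∈C₂)
  v′∈C₂ : v′ onCycle C₂
  v′∈C₂ = proj₁ (proj₂ (other-edge C₂ v∈C₂))
  v′≢v : v′ ≢ v
  v′≢v = proj₂ (proj₂ (other-edge C₂ v∈C₂))
  S₁ S₂ S : Subset _
  S₁ = edgeSet C₁ - u
  S₂ = edgeSet C₂ - v′
  S = S₁ ∪ S₂
  u∉S : u ∉ S
  u∉S = [ x∉p-x u , disjoint u u∈C₁ ∘ ∈edgeSet-⁻ C₂ ]′ ∘ x∈p∪q⁻ S₁ S₂
  v′∉S : v′ ∉ S
  v′∉S = [ (λ v′∈S₁ → disjoint v′ (∈edgeSet-⁻ C₁ v′∈S₁) v′∈C₂) , x∉p-x v′ ]′ ∘ x∈p∪q⁻ S₁ S₂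

lemma9 : (m s n : ℕ) (Φ : Scheme m s) → Forced n Φ →
    Σ (Subset m) λ S → ∣ S ∣ ≤ n ×
    ¬ (∃[ A ] ∃[ B ] ∃[ C ] Represents Φ A B C S)
lemma9 m s n Φ = [ P1⇒unrepresentable , P2⇒unrepresentable ]′
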